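{- Every TP-framework $(G,\rho)$ is walk-independent.
   Context: All graphs are simple, undirected, connected and possibly countably infinite. A placement is $\rho:V_G\to\mathbb{R}^2$ with $\rho(u)\neq\rho(v)$ for edges $uv$. A parallelogram placement is an injective placement such that each induced 4-cycle forms a non-degenerate parallelogram (vertices not all collinear). An abstract simplicial complex $X$ is a collection of finite sets such that every non-empty subset of a member is a member; its members are faces, of dimension $|S|-1$. A walk from $u$ to $v$ in $X$ is a sequence $(u=u_0,\dots,u_n=v)$, $n\ge1$, with $\{u_{i-1},u_i\}\in X$ for all $i$ (repetitions $u_{i-1}=u_i$ allowed); closed if $u=v$. A move omits some $u_i$, $1\le i\le n-1$, such that $\{u_{i-1},u_i,u_{i+1}\}\in X$, or is the inverse operation; two closed walks based at $u$ are homotopic if related by a sequence of moves. $X$ is simply connected if its 1-skeleton is a connected graph and every closed walk based at a fixed vertex $u$ is homotopic to $(u,u)$. For a graph $G$, $\mathcal{X}(G)$ is the 2-dimensional complex consisting of: all singletons $\{v\}$, $v\in V_G$; all edges $\{u,v\}\in E_G$; all $\{u,v,w\}$ with $(u,v,w,u)$ a 3-cycle of $G$; all $\{u,w\}$ such that $(u,v,w,z,u)$ is a 4-cycle of $G$ for some $v,z$; all $\{u,v,w\}$ such that $(u,v,w,z,u)$ is an induced 4-cycle of $G$ for some $z$. A framework $(G,\rho)$ is a TP-framework if $\rho$ is a parallelogram placement of $G$, every 3-cycle of $G$ forms a non-degenerate triangle in $\rho$, and $\mathcal{X}(G)$ is simply connected. Angle-preserving classes: edges are in relation $\triangle$ if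 they lie in a common 3-cycle subgraph of $G$, and in relation $\square$ if they are opposite edges of a 4-cycle subgraph; the angle-preserving classes are the classes of the reflexive-transitive closure of $\triangle\cup\square$ on $E_G$. $(G,\rho)$ is walk-independent if $\rho$ is a parallelogram placement and for every angle-preserving class $r$ and every closed walk $C=(u_1,\dots,u_k)$ in $G$ ($u_1=u_k$), $\sum(\rho(u_{i+1})-\rho(u_i))=(0,0)$ over all $1\le i<k$ with $u_iu_{i+1}\in r$. -}

module Defs where

open import Level using (0ℓ)
open import Data.Nat using (ℕ)
open import Data.Product using (Σ; ∃; ∃-syntax; _×_; _,_)
open import Data.Sum using (_⊎_)
open import Data.Empty using (⊥)
open import Data.List using (List; []; _∷_; _++_; [_])
open import Data.List.Relation.Unary.All using (All)
open import Data.List.Relation.Unary.Linked using (Linked)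
open import Data.List.Relation.Binary.Subset.Propositional using (_⊆_)
open import Relation.Nullary using (¬_)
open import Relation.Binary.PropositionalEquality using (_≡_; _≢_)
open import Relation.Binary.Construct.Closure.ReflexiveTransitive using (Star)
open import Function.Definitions using (Injective)

-- The real numbers, axiomatically: a complete ordered field.
-- (agda-stdlib has no ℝ; every model of these axioms is isomorphic to ℝ.)

record RealNumbers : Set₁ where
  infixl 6 _+_
  infixl 7 _*_
  infix 4 _≤_
  field
    ℝ     : Set
    0# 1# : ℝ
    _+_ _*_ : ℝ → ℝ → ℝ
    -_    : ℝ → ℝ
    _≤_   : ℝ → ℝ → Set
    +-assoc    : ∀ x y z → (x + y) + z ≡ x + (y + z)
    +-comm     : ∀ x y → x + y ≡ y + x
    +-identity : ∀ x → 0# + x ≡ x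
    +-inverse  : ∀ x → (- x) + x ≡ 0#
    *-assoc    : ∀ x y z → (x * y) * z ≡ x * (y * z)
    *-comm     : ∀ x y → x * y ≡ y * x
    *-identity : ∀ x → 1# * x ≡ x
    distrib    : ∀ x y z → x * (y + z) ≡ (x * y) + (x * z)
    0≢1        : 0# ≢ 1#
    *-inverse  : ∀ x → x ≢ 0# → ∃[ y ] (y * x ≡ 1#)
    ≤-refl     : ∀ x → x ≤ x
    ≤-antisym  : ∀ {x y} → x ≤ y → y ≤ x → x ≡ y
    ≤-trans    : ∀ {x y z} → x ≤ y → y ≤ z → x ≤ z
    ≤-total    : ∀ x y → x ≤ y ⊎ y ≤ x
    +-mono-≤   : ∀ {x y} z → x ≤ y → x + z ≤ y + z
    *-nonneg   : ∀ {x y} → 0# ≤ x → 0# ≤ y → 0# ≤ x * y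
    complete   : (P : ℝ → Set) → ∃[ x ] P x → ∃[ b ] (∀ x → P x → x ≤ b) →
                 ∃[ s ] ((∀ x → P x → x ≤ s) × (∀ b → (∀ x → P x → x ≤ b) → s ≤ b))

record Graph : Set₁ where
  field
    V     : Set
    Adj   : V → V → Set
    sym   : ∀ {u v} → Adj u v → Adj v u
    irrefl : ∀ {u} → ¬ Adj u u
    countable : Σ (V → ℕ) (Injective _≡_ _≡_)
    connected : ∀ u v → u ≡ v ⊎ ∃[ xs ] Linked Adj (u ∷ xs ++ [ v ])

module _ (R : RealNumbers) (G : Graph) where
  open RealNumbers R
  open Graph G

  ℝ² : Set
  ℝ² = ℝ × ℝ

  0² : ℝ²
  0² = 0# , 0#

  _+²_ : ℝ² → ℝ² → ℝ²
  (a , b) +² (c , d) = (a + c) , (b + d)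

  _-²_ : ℝ² → ℝ² → ℝ²
  (a , b) -² (c , d) = (a + (- c)) , (b + (- d))

  Collinear : List ℝ² → Set
  Collinear ps = ∃[ α ] ∃[ β ] ∃[ γ ]
    (¬ (α ≡ 0# × β ≡ 0#) × All (λ { (x , y) → α * x + β * y ≡ γ }) ps)

  Cycle3 : V → V → V → Set
  Cycle3 u v w = Adj u v × Adj v w × Adj w u

  Cycle4 : V → V → V → V → Set
  Cycle4 u v w z = u ≢ w × v ≢ z × Adj u v × Adj v w × Adj w z × Adj z u

  Induced4 : V → V → V → V → Set
  Induced4 u v w z = Cycle4 u v w z × ¬ Adj u w × ¬ Adj v z

  IsPlacement : (V → ℝ²) → Set
  IsPlacement ρ = ∀ {u v} → Adj u v → ρ u ≢ ρ v

  IsParallelogramPlacement : (V → ℝ²) → Set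
  IsParallelogramPlacement ρ =
    IsPlacement ρ × Injective _≡_ _≡_ ρ ×
    (∀ u v w z → Induced4 u v w z →
       (ρ v -² ρ u ≡ ρ w -² ρ z) × ¬ Collinear (ρ u ∷ ρ v ∷ ρ w ∷ ρ z ∷ []))

  -- The complex 𝒳(G); a finite set is given by a list, compared as a set

  _≋_ : List V → List V → Set
  S ≋ T = S ⊆ T × T ⊆ S

  InX : List V → Set
  InX S =
      (∃[ v ] S ≋ (v ∷ []))
    ⊎ (∃[ u ] ∃[ v ] (Adj u v × S ≋ (u ∷ v ∷ [])))
    ⊎ (∃[ u ] ∃[ v ] ∃[ w ] ∃[ z ] (Cycle4 u v w z × S ≋ (u ∷ w ∷ [])))
    ⊎ (∃[ u ] ∃[ v ] ∃[ w ] (Cycle3 u v w × S ≋ (u ∷ v ∷ w ∷ [])))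
    ⊎ (∃[ u ] ∃[ v ] ∃[ w ] ∃[ z ] (Induced4 u v w z × S ≋ (u ∷ v ∷ w ∷ [])))

  XWalk : V → V → List V → Set
  XWalk u v W = ∃[ xs ] (W ≡ u ∷ xs ++ [ v ]) × Linked (λ a b → InX (a ∷ b ∷ [])) W

  data Move : List V → List V → Set where
    omit   : ∀ pre x y z suf → InX (x ∷ y ∷ z ∷ []) →
             Move (pre ++ x ∷ y ∷ z ∷ suf) (pre ++ x ∷ z ∷ suf)
    insert : ∀ pre x y z suf → InX (x ∷ y ∷ z ∷ []) →
             Move (pre ++ x ∷ z ∷ suf) (pre ++ x ∷ y ∷ z ∷ suf)

  Homotopic : List V → List V → Set
  Homotopic = Star Move

  SimplyConnectedX : Set
  SimplyConnectedX =
    (∀ u v → ∃[ W ] XWalk u v W) ×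
    (∃[ u ] (∀ W → XWalk u u W → Homotopic W (u ∷ u ∷ [])))

  IsTPFramework : (V → ℝ²) → Set
  IsTPFramework ρ =
    IsParallelogramPlacement ρ ×
    (∀ u v w → Cycle3 u v w → ¬ Collinear (ρ u ∷ ρ v ∷ ρ w ∷ [])) ×
    SimplyConnectedX

  -- Angle-preserving classes.  An edge uv is represented by the ordered
  -- pair (u , v) with Adj u v; both orientations are identified.

  data APStep : V × V → V × V → Set where
    flip : ∀ {u v} → Adj u v → APStep (u , v) (v , u)
    tri  : ∀ {u v w} → Cycle3 u v w → APStep (u , v) (v , w)
    sq   : ∀ {u v w z} → Cycle4 u v w z → APStep (u , v) (w , z)

  data APSym : V × V → V × V → Set where
    fwd : ∀ {e f} → APStep e f → APSym e f
    bwd : ∀ {e f} → APStep f e → APSym e f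

  SameClass : V × V → V × V → Set
  SameClass = Star APSym

  data ClassSum (ρ : V → ℝ²) (r : V × V) : List V → ℝ² → Set where
    end  : ∀ x → ClassSum ρ r (x ∷ []) 0²
    inR  : ∀ {x y xs s} → SameClass (x , y) r → ClassSum ρ r (y ∷ xs) s →
           ClassSum ρ r (x ∷ y ∷ xs) ((ρ y -² ρ x) +² s)
    outR : ∀ {x y xs s} → ¬ SameClass (x , y) r → ClassSum ρ r (y ∷ xs) s →
           ClassSum ρ r (x ∷ y ∷ xs) s

  ClosedWalk : List V → Set
  ClosedWalk C = ∃[ u ] ∃[ xs ] (C ≡ u ∷ xs ++ [ u ]) × Linked Adj C

  WalkIndependent : (V → ℝ²) → Set
  WalkIndependent ρ =
    IsParallelogramPlacement ρ ×
    (∀ a b → Adj a b → ∀ C → ClosedWalk C → ∀ s → ClassSum ρ (a , b) C s → s ≡ 0²)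

{-# OPTIONS --safe #-}
module Submission where

open import Level using (0ℓ)
open import Function using (_∘_)
open import Data.Product using (Σ-syntax; ∃; ∃-syntax; _×_; _,_; proj₁; proj₂; zip)
open import Data.Sum using (_⊎_; inj₁; inj₂)
open import Data.Empty using (⊥-elim)
open import Data.List using (List; []; _∷_; _++_)
open import Data.List.Membership.Propositional using (_∈_)
open import Data.List.Relation.Unary.Any using (here; there)
open import Data.List.Relation.Unary.Linked as Linked using (Linked; [-]; _∷_)
open import Data.List.Relation.Binary.Subset.Propositional using (_⊆_)
open import Data.List.Relation.Binary.Subset.Propositional.Properties using (⊆-refl; xs⊆xs++ys)
open import Relation.Nullary using (¬_)
open import Relation.Nullary.Negation using (¬¬-map)
open import Relation.Binary.PropositionalEquality
  using (_≡_; _≢_; refl; sym; trans; cong; cong₂; subst; subst₂; isEquivalence; module ≡-Reasoning)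
import Relation.Binary.Construct.Closure.ReflexiveTransitive as Star
open import Algebra.Bundles using (AbelianGroup)
open import Algebra.Consequences.Propositional using (comm∧idˡ⇒id; comm∧invˡ⇒inv)

open import Defs

-- Fix the class of r, and let δ x y be ρ y - ρ x on the edges of that class and 0 on the
-- other edges. The edges of a triangle lie in one class, and so do the four edges of a
-- 4-cycle with a chord; a chordless 4-cycle is a parallelogram whose opposite sides lie
-- in one class. Hence δ x v + δ v y is the same for every 4-cycle (x, v, y, z), so δ
-- extends to the diagonals, and this extension is a cocycle on 𝒳(G): on every 2-face the
-- two short sides add up to the long one. Sums of a cocycle along walks are invariant
-- under moves, so they vanish on null-homotopic loops, and a class sum of a closed walk
-- is such a sum once the walk is conjugated by a walk from the base point.

module AbelianGroupLemmas {c ℓ} (𝔾 : AbelianGroup c ℓ) where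
  open AbelianGroup 𝔾
  open import Relation.Binary.Reasoning.Setoid setoid

  telescope : ∀ a b c → (b - a) ∙ (c - b) ≈ c - a
  telescope a b c = begin
    (b - a) ∙ (c - b)         ≈⟨ comm _ _ ⟩
    (c ∙ b ⁻¹) ∙ (b ∙ a ⁻¹)   ≈⟨ assoc _ _ _ ⟩
    c ∙ (b ⁻¹ ∙ (b ∙ a ⁻¹))   ≈⟨ ∙-congˡ (assoc _ _ _) ⟨
    c ∙ ((b ⁻¹ ∙ b) ∙ a ⁻¹)   ≈⟨ ∙-congˡ (∙-congʳ (inverseˡ b)) ⟩
    c ∙ (ε ∙ a ⁻¹)            ≈⟨ ∙-congˡ (identityˡ _) ⟩
    c - a                     ∎

  ε-sandwich : ∀ a b s → a ∙ b ≈ ε → a ∙ (s ∙ b) ≈ ε → s ≈ ε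
  ε-sandwich a b s ab≈ε asb≈ε = begin
    s             ≈⟨ identityʳ s ⟨
    s ∙ ε         ≈⟨ ∙-congˡ ab≈ε ⟨
    s ∙ (a ∙ b)   ≈⟨ assoc s a b ⟨
    (s ∙ a) ∙ b   ≈⟨ ∙-congʳ (comm s a) ⟩
    (a ∙ s) ∙ b   ≈⟨ assoc a s b ⟩
    a ∙ (s ∙ b)   ≈⟨ asb≈ε ⟩
    ε             ∎

module RealProperties (R : RealNumbers) where
  open RealNumbers R

  +-abelianGroup : AbelianGroup 0ℓ 0ℓ
  +-abelianGroup = record
    { isAbelianGroup = record
      { isGroup = record
        { isMonoid = record
          { isSemigroup = record
            { isMagma = record { isEquivalence = isEquivalence ; ∙-cong = cong₂ _+_ }
            ; assoc = +-assoc }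
          ; identity = comm∧idˡ⇒id +-comm +-identity }
        ; inverse = comm∧invˡ⇒inv +-comm +-inverse
        ; ⁻¹-cong = cong -_ }
      ; comm = +-comm } }

  open AbelianGroup +-abelianGroup using (inverseʳ)
  open import Algebra.Properties.AbelianGroup +-abelianGroup
    using (identityʳ-unique; inverseˡ-unique; ⁻¹-involutive)
  open ≡-Reasoning

  *-zeroʳ : ∀ x → x * 0# ≡ 0#
  *-zeroʳ x = identityʳ-unique (x * 0#) (x * 0#) (begin
    x * 0# + x * 0#   ≡⟨ distrib x 0# 0# ⟨
    x * (0# + 0#)     ≡⟨ cong (x *_) (+-identity 0#) ⟩
    x * 0#            ∎)

  -1*-1≡1 : (- 1#) * (- 1#) ≡ 1#
  -1*-1≡1 = trans (inverseˡ-unique _ _ (begin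
    (- 1#) * (- 1#) + (- 1#)
      ≡⟨ cong ((- 1#) * (- 1#) +_) (trans (*-comm (- 1#) 1#) (*-identity (- 1#))) ⟨
    (- 1#) * (- 1#) + (- 1#) * 1#   ≡⟨ distrib (- 1#) (- 1#) 1# ⟨
    (- 1#) * ((- 1#) + 1#)          ≡⟨ cong ((- 1#) *_) (+-inverse 1#) ⟩
    (- 1#) * 0#                     ≡⟨ *-zeroʳ (- 1#) ⟩
    0#                              ∎)) (⁻¹-involutive 1#)

  1≰0 : ¬ 1# ≤ 0#
  1≰0 1≤0 = 0≢1 (≤-antisym 0≤1 1≤0)
    where
      0≤-1 : 0# ≤ - 1#
      0≤-1 = subst₂ _≤_ (inverseʳ 1#) (+-identity (- 1#)) (+-mono-≤ (- 1#) 1≤0)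
      0≤1 : 0# ≤ 1#
      0≤1 = subst (0# ≤_) -1*-1≡1 (*-nonneg 0≤-1 0≤-1)

  0≰-1 : ¬ 0# ≤ - 1#
  0≰-1 0≤-1 = 1≰0 (subst₂ _≤_ (+-identity 1#) (+-inverse 1#) (+-mono-≤ 1# 0≤-1))

  -1≤1 : - 1# ≤ 1#
  -1≤1 with ≤-total 0# 1#
  ... | inj₂ 1≤0 = ⊥-elim (1≰0 1≤0)
  ... | inj₁ 0≤1 = ≤-trans (subst₂ _≤_ (+-identity (- 1#)) (inverseʳ 1#) (+-mono-≤ (- 1#) 0≤1)) 0≤1

  -- The supremum of {-1} ∪ {1 | A} is ≤ 0 only if ¬ A, and ≥ 0 only if ¬ ¬ A.
  weak-excluded-middle : (A : Set) → ¬ A ⊎ ¬ ¬ A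
  weak-excluded-middle A = decide (complete P (- 1# , inj₁ refl) (1# , P≤1))
    where
      P : ℝ → Set
      P t = t ≡ - 1# ⊎ (t ≡ 1# × A)

      P≤1 : ∀ t → P t → t ≤ 1#
      P≤1 _ (inj₁ refl)       = -1≤1
      P≤1 _ (inj₂ (refl , _)) = ≤-refl 1#

      decide : ∃[ s ] ((∀ t → P t → t ≤ s) × (∀ b → (∀ t → P t → t ≤ b) → s ≤ b)) → ¬ A ⊎ ¬ ¬ A
      decide (s , upper , least) with ≤-total s 0#
      ... | inj₁ s≤0 = inj₁ λ a → 1≰0 (≤-trans (upper 1# (inj₂ (refl , a))) s≤0)
      ... | inj₂ 0≤s = inj₂ λ ¬a → 0≰-1 (≤-trans 0≤s (least (- 1#) λ
              { _ (inj₁ refl)    → ≤-refl (- 1#)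
              ; _ (inj₂ (_ , a)) → ⊥-elim (¬a a) }))

-- The graph is a dummy argument: Defs defines _+²_ relative to a graph.
ℝ²-abelianGroup : RealNumbers → Graph → AbelianGroup 0ℓ 0ℓ
ℝ²-abelianGroup R G = record
  { _∙_ = _+²_ R G
  ; ε = 0² R G
  ; _⁻¹ = λ { (a , b) → (- a , - b) }
  ; isAbelianGroup = record
    { isGroup = record
      { isMonoid = record
        { isSemigroup = record
          { isMagma = record { isEquivalence = isEquivalence ; ∙-cong = cong₂ (_+²_ R G) }
          ; assoc = λ _ _ _ → cong₂ _,_ (+-assoc _ _ _) (+-assoc _ _ _) }
        ; identity = comm∧idˡ⇒id +²-comm λ _ → cong₂ _,_ (+-identity _) (+-identity _) }
      ; inverse = comm∧invˡ⇒inv +²-comm λ _ → cong₂ _,_ (+-inverse _) (+-inverse _)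
      ; ⁻¹-cong = λ { refl → refl } }
    ; comm = +²-comm } }
  where
    open RealNumbers R
    +²-comm : ∀ p q → _+²_ R G p q ≡ _+²_ R G q p
    +²-comm _ _ = cong₂ _,_ (+-comm _ _) (+-comm _ _)

module _ {A : Set} {_~_ : A → A → Set} where

  Linked-⁀ : ∀ {u v w ys} xs → Linked _~_ (u ∷ xs ++ v ∷ []) → Linked _~_ (v ∷ ys ++ w ∷ []) →
             Linked _~_ (u ∷ (xs ++ v ∷ ys) ++ w ∷ [])
  Linked-⁀ []       (u~v ∷ [-]) L = u~v ∷ L
  Linked-⁀ (_ ∷ xs) (u~x ∷ L) L′  = u~x ∷ Linked-⁀ xs L L′

module WalkSums (R : RealNumbers) (G : Graph) (Step : Graph.V G → Graph.V G → ℝ² R G → Set) where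
  open Graph G using (V)
  open Star using (ε; _◅_)
  open AbelianGroup (ℝ²-abelianGroup R G) using (_∙_; _-_; assoc; identityʳ; inverseʳ)
    renaming (ε to 𝟎)
  open AbelianGroupLemmas (ℝ²-abelianGroup R G) using (telescope)

  XAdj : V → V → Set
  XAdj x y = InX R G (x ∷ y ∷ [])

  Potential : List V → Set
  Potential S = Σ[ φ ∈ (∀ {x} → x ∈ S → ℝ² R G) ]
                  (∀ {x y} (i : x ∈ S) (j : y ∈ S) → Step x y (φ j - φ i))

  Potential-⊆ : ∀ {S T} → S ⊆ T → Potential T → Potential S
  Potential-⊆ S⊆T (φ , consistent) = (λ i → φ (S⊆T i)) , λ i j → consistent (S⊆T i) (S⊆T j)

  data WalkSum : List V → ℝ² R G → Set where
    [_] : ∀ x → WalkSum (x ∷ []) 𝟎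
    _∷_ : ∀ {x y xs d s} → Step x y d → WalkSum (y ∷ xs) s → WalkSum (x ∷ y ∷ xs) (d ∙ s)

  WalkSum-⁀ : ∀ {u v w ys s t} xs → WalkSum (u ∷ xs ++ v ∷ []) s → WalkSum (v ∷ ys ++ w ∷ []) t →
              WalkSum (u ∷ (xs ++ v ∷ ys) ++ w ∷ []) (s ∙ t)
  WalkSum-⁀ []       (uv ∷ [ _ ]) T = subst (WalkSum _) (cong (_∙ _) (sym (identityʳ _))) (uv ∷ T)
  WalkSum-⁀ (_ ∷ xs) (ux ∷ S)     T = subst (WalkSum _) (sym (assoc _ _ _)) (ux ∷ WalkSum-⁀ xs S T)

  WalkSum-under-prefix : ∀ pre {x ws ws′} → (∀ {s} → WalkSum (x ∷ ws) s → WalkSum (x ∷ ws′) s) →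
                         ∀ {s} → WalkSum (pre ++ x ∷ ws) s → WalkSum (pre ++ x ∷ ws′) s
  WalkSum-under-prefix []            f S        = f S
  WalkSum-under-prefix (_ ∷ [])      f (st ∷ S) = st ∷ f S
  WalkSum-under-prefix (_ ∷ y ∷ pre) f (st ∷ S) = st ∷ WalkSum-under-prefix (y ∷ pre) f S

  module Cocycle (Step-functional : ∀ {x y d d′} → Step x y d → Step x y d′ → d ≡ d′)
                 (face-potential : ∀ {S} → InX R G S → Potential S) where

    step-self : ∀ x → Step x x 𝟎
    step-self x with face-potential (inj₁ (x , ⊆-refl , ⊆-refl))
    ... | φ , consistent = subst (Step x x) (inverseʳ _) (consistent (here refl) (here refl))

    step-exists : ∀ {x y} → XAdj x y → ∃ (Step x y)
    step-exists xy with face-potential xy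
    ... | φ , consistent = _ , consistent (here refl) (there (here refl))

    face-steps : ∀ {x y z} → InX R G (x ∷ y ∷ z ∷ []) → ∃ (Step x y) × ∃ (Step y z)
    face-steps xyz with face-potential xyz
    ... | φ , consistent = (_ , consistent (here refl) (there (here refl)))
                         , (_ , consistent (there (here refl)) (there (there (here refl))))

    face-composite : ∀ {x y z d e} → InX R G (x ∷ y ∷ z ∷ []) →
                     Step x y d → Step y z e → Step x z (d ∙ e)
    face-composite {x} {y} {z} {d} {e} xyz xy yz with face-potential xyz
    ... | φ , consistent = subst (Step x z) (begin
        φ k - φ i                 ≡⟨ telescope (φ i) (φ j) (φ k) ⟨
        (φ j - φ i) ∙ (φ k - φ j) ≡⟨ cong₂ _∙_ (Step-functional (consistent i j) xy)
                                               (Step-functional (consistent j k) yz) ⟩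
        d ∙ e                     ∎) (consistent i k)
      where
        open ≡-Reasoning
        i : x ∈ x ∷ y ∷ z ∷ []
        i = here refl
        j : y ∈ x ∷ y ∷ z ∷ []
        j = there (here refl)
        k : z ∈ x ∷ y ∷ z ∷ []
        k = there (there (here refl))

    omit-vertex : ∀ {x y z ws s} → InX R G (x ∷ y ∷ z ∷ []) →
                  WalkSum (x ∷ y ∷ z ∷ ws) s → WalkSum (x ∷ z ∷ ws) s
    omit-vertex xyz (_∷_ {d = d} xy (_∷_ {d = e} {s = s} yz S)) =
      subst (WalkSum _) (assoc d e s) (face-composite xyz xy yz ∷ S)

    insert-vertex : ∀ {x y z ws s} → InX R G (x ∷ y ∷ z ∷ []) →
                    WalkSum (x ∷ z ∷ ws) s → WalkSum (x ∷ y ∷ z ∷ ws) s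
    insert-vertex xyz (_∷_ {s = s} xz S) with face-steps xyz
    ... | (d , xy) , (e , yz) = subst (WalkSum _)
          (trans (sym (assoc d e s)) (cong (_∙ s) (Step-functional (face-composite xyz xy yz) xz)))
          (xy ∷ (yz ∷ S))

    WalkSum-homotopic : ∀ {W W′ s} → Homotopic R G W W′ → WalkSum W s → WalkSum W′ s
    WalkSum-homotopic ε S = S
    WalkSum-homotopic (omit pre _ _ _ _ xyz ◅ ms) S =
      WalkSum-homotopic ms (WalkSum-under-prefix pre (omit-vertex xyz) S)
    WalkSum-homotopic (insert pre _ _ _ _ xyz ◅ ms) S =
      WalkSum-homotopic ms (WalkSum-under-prefix pre (insert-vertex xyz) S)

    walkSum-exists : ∀ {x xs} → Linked XAdj (x ∷ xs) → ∃ (WalkSum (x ∷ xs))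
    walkSum-exists [-]      = 𝟎 , [ _ ]
    walkSum-exists (xy ∷ L) = zip _∙_ _∷_ (step-exists xy) (walkSum-exists L)

    null-homotopic-sum : ∀ {u xs s} → (∀ W → XWalk R G u u W → Homotopic R G W (u ∷ u ∷ [])) →
                         Linked XAdj (u ∷ xs ++ u ∷ []) → WalkSum (u ∷ xs ++ u ∷ []) s → s ≡ 𝟎
    null-homotopic-sum {u} {xs} null L S with WalkSum-homotopic (null _ (xs , refl , L)) S
    ... | uu ∷ [ _ ] = trans (identityʳ _) (Step-functional uu (step-self u))

module ClassDisplacement (R : RealNumbers) (G : Graph) (ρ : Graph.V G → ℝ² R G)
  (parallelogram : ∀ {x v y z} → Induced4 R G x v y z → _-²_ R G (ρ v) (ρ x) ≡ _-²_ R G (ρ y) (ρ z))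
  (r : Graph.V G × Graph.V G) where

  open Graph G renaming (sym to Adj-sym)
  open AbelianGroup (ℝ²-abelianGroup R G)
    using (_∙_; _⁻¹; _-_; comm; identityˡ; identityʳ; inverseʳ)
    renaming (ε to 𝟎)
  open import Algebra.Properties.AbelianGroup (ℝ²-abelianGroup R G)
    using (ε⁻¹≈ε; ⁻¹-anti-homo‿-; ⁻¹-anti-homo-∙; xyx⁻¹≈y; loop)
  open import Algebra.Properties.Loop loop using (x//ε≈x)
  open AbelianGroupLemmas (ℝ²-abelianGroup R G) using (telescope; ε-sandwich)
  open RealProperties R using (weak-excluded-middle)
  open Star using (ε; _◅_; _◅◅_; reverse)
  open ≡-Reasoning

  _∼_ : V × V → V × V → Set
  e ∼ f = ¬ ¬ SameClass R G e f

  ∼-sym : ∀ {e f} → e ∼ f → f ∼ e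
  ∼-sym = ¬¬-map (reverse λ { (fwd s) → bwd s ; (bwd s) → fwd s })

  ∼-trans : ∀ {e f g} → e ∼ f → f ∼ g → e ∼ g
  ∼-trans e∼f f∼g ¬e~g = e∼f λ e~f → f∼g λ f~g → ¬e~g (e~f ◅◅ f~g)

  -- Membership in the class of r is taken up to double negation, which
  -- weak excluded middle decides.
  InClass : V × V → Set
  InClass e = e ∼ r

  classified : ∀ e → InClass e ⊎ ¬ InClass e
  classified e with weak-excluded-middle (SameClass R G e r)
  ... | inj₁ ¬e~r  = inj₂ λ e∼r → e∼r ¬e~r
  ... | inj₂ e∼r   = inj₁ e∼r

  restrict : V × V → ℝ² R G → ℝ² R G
  restrict e d with classified e
  ... | inj₁ _ = d
  ... | inj₂ _ = 𝟎

  restrict-∼ : ∀ {e f d} → e ∼ f → restrict e d ≡ restrict f d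
  restrict-∼ {e} {f} e∼f with classified e | classified f
  ... | inj₁ _   | inj₁ _   = refl
  ... | inj₂ _   | inj₂ _   = refl
  ... | inj₁ e∈r | inj₂ f∉r = ⊥-elim (f∉r (∼-trans (∼-sym e∼f) e∈r))
  ... | inj₂ e∉r | inj₁ f∈r = ⊥-elim (e∉r (∼-trans e∼f f∈r))

  restrict-∙ : ∀ e c d → restrict e (c ∙ d) ≡ restrict e c ∙ restrict e d
  restrict-∙ e c d with classified e
  ... | inj₁ _ = refl
  ... | inj₂ _ = sym (identityˡ 𝟎)

  restrict-⁻¹ : ∀ e d → restrict e (d ⁻¹) ≡ restrict e d ⁻¹
  restrict-⁻¹ e d with classified e
  ... | inj₁ _ = refl
  ... | inj₂ _ = sym ε⁻¹≈ε

  restrict-in-class : ∀ {e d} → SameClass R G e r → restrict e d ≡ d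
  restrict-in-class {e} e~r with classified e
  ... | inj₁ _   = refl
  ... | inj₂ e∉r = ⊥-elim (e∉r λ ¬e~r → ¬e~r e~r)

  restrict-out-of-class : ∀ {e d} → ¬ SameClass R G e r → restrict e d ≡ 𝟎
  restrict-out-of-class {e} ¬e~r with classified e
  ... | inj₁ e∈r = ⊥-elim (e∈r ¬e~r)
  ... | inj₂ _   = refl

  δ : V → V → ℝ² R G
  δ x y = restrict (x , y) (ρ y - ρ x)

  APStep⇒∼ : ∀ {e f} → APStep R G e f → e ∼ f
  APStep⇒∼ s ¬e~f = ¬e~f (fwd s ◅ ε)

  δ-antisym : ∀ {x y} → Adj x y → δ y x ≡ δ x y ⁻¹
  δ-antisym {x} {y} xy = begin
    restrict (y , x) (ρ x - ρ y)          ≡⟨ restrict-∼ (APStep⇒∼ (flip (Adj-sym xy))) ⟩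
    restrict (x , y) (ρ x - ρ y)          ≡⟨ cong (restrict (x , y)) (⁻¹-anti-homo‿- (ρ y) (ρ x)) ⟨
    restrict (x , y) ((ρ y - ρ x) ⁻¹)     ≡⟨ restrict-⁻¹ (x , y) (ρ y - ρ x) ⟩
    δ x y ⁻¹                              ∎

  δ-path : ∀ {x v y} → (x , v) ∼ (v , y) → δ x v ∙ δ v y ≡ restrict (x , v) (ρ y - ρ x)
  δ-path {x} {v} {y} xv∼vy = begin
    δ x v ∙ restrict (v , y) (ρ y - ρ v)              ≡⟨ cong (δ x v ∙_) (restrict-∼ (∼-sym xv∼vy)) ⟩
    δ x v ∙ restrict (x , v) (ρ y - ρ v)              ≡⟨ restrict-∙ (x , v) _ _ ⟨
    restrict (x , v) ((ρ v - ρ x) ∙ (ρ y - ρ v))      ≡⟨ cong (restrict (x , v)) (telescope (ρ x) (ρ v) (ρ y)) ⟩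
    restrict (x , v) (ρ y - ρ x)                      ∎

  δ-triangle : ∀ {x v y} → Cycle3 R G x v y → δ x v ∙ δ v y ≡ δ x y
  δ-triangle t@(xv , vy , yx) = trans (δ-path (APStep⇒∼ (tri t)))
    (restrict-∼ (∼-trans (APStep⇒∼ (tri t))
                (∼-trans (APStep⇒∼ (tri (vy , yx , xv))) (APStep⇒∼ (flip yx)))))

  Cycle4-rotate : ∀ {x v y z} → Cycle4 R G x v y z → Cycle4 R G v y z x
  Cycle4-rotate (x≢y , v≢z , xv , vy , yz , zx) = v≢z , (λ y≡x → x≢y (sym y≡x)) , vy , yz , zx , xv

  Cycle4-reverse : ∀ {x v y z} → Cycle4 R G x v y z → Cycle4 R G y v x z
  Cycle4-reverse (x≢y , v≢z , xv , vy , yz , zx) =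
    (λ y≡x → x≢y (sym y≡x)) , v≢z , Adj-sym vy , Adj-sym xv , Adj-sym zx , Adj-sym yz

  Induced4-rotate : ∀ {x v y z} → Induced4 R G x v y z → Induced4 R G v y z x
  Induced4-rotate (c , ¬xy , ¬vz) = Cycle4-rotate c , ¬vz , ¬xy ∘ Adj-sym

  SameClassSquare : V → V → V → V → Set
  SameClassSquare x v y z = SameClass R G (x , v) (v , y) × SameClass R G (x , z) (z , y)
                          × SameClass R G (x , v) (x , z)

  square-with-chord-xy : ∀ {x v y z} → Cycle4 R G x v y z → Adj x y → SameClassSquare x v y z
  square-with-chord-xy {x} {y = y} {z} (_ , _ , xv , vy , yz , zx) xy =
      fwd (tri (xv , vy , yx)) ◅ ε
    , fwd (tri (xz , zy , yx)) ◅ ε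
    , fwd (tri (xv , vy , yx)) ◅ fwd (tri (vy , yx , xv)) ◅ fwd (tri (yx , xz , zy)) ◅ ε
    where
      yx : Adj y x
      yx = Adj-sym xy
      xz : Adj x z
      xz = Adj-sym zx
      zy : Adj z y
      zy = Adj-sym yz

  square-with-chord-vz : ∀ {x v y z} → Cycle4 R G x v y z → Adj v z → SameClassSquare x v y z
  square-with-chord-vz {x} {v} {z = z} (_ , _ , xv , vy , yz , zx) vz =
      fwd (tri (xv , vz , zx)) ◅ fwd (flip vz) ◅ fwd (tri (zv , vy , yz)) ◅ ε
    , fwd (tri (xz , zv , Adj-sym xv)) ◅ fwd (tri (zv , vy , yz)) ◅ fwd (tri (vy , yz , zv))
        ◅ fwd (flip yz) ◅ ε
    , fwd (tri (xv , vz , zx)) ◅ fwd (tri (vz , zx , xv)) ◅ fwd (flip zx) ◅ ε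
    where
      zv : Adj z v
      zv = Adj-sym vz
      xz : Adj x z
      xz = Adj-sym zx

  δ-square-in-class : ∀ {x v y z} → ¬ ¬ SameClassSquare x v y z → δ x v ∙ δ v y ≡ δ x z ∙ δ z y
  δ-square-in-class {x} {v} {y} {z} same = begin
    δ x v ∙ δ v y                   ≡⟨ δ-path (¬¬-map proj₁ same) ⟩
    restrict (x , v) (ρ y - ρ x)    ≡⟨ restrict-∼ (¬¬-map (proj₂ ∘ proj₂) same) ⟩
    restrict (x , z) (ρ y - ρ x)    ≡⟨ δ-path (¬¬-map (proj₁ ∘ proj₂) same) ⟨
    δ x z ∙ δ z y                   ∎

  δ-square-induced : ∀ {x v y z} → Induced4 R G x v y z → δ x v ∙ δ v y ≡ δ x z ∙ δ z y
  δ-square-induced {x} {v} {y} {z} ind@(c@(_ , _ , _ , _ , yz , zx) , _) = begin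
    restrict (x , v) (ρ v - ρ x) ∙ restrict (v , y) (ρ y - ρ v)
      ≡⟨ cong₂ _∙_ (trans (restrict-∼ xv∼zy) (cong (restrict (z , y)) (parallelogram ind)))
                   (trans (restrict-∼ vy∼xz) (cong (restrict (x , z)) (parallelogram (Induced4-rotate ind)))) ⟩
    δ z y ∙ δ x z
      ≡⟨ comm _ _ ⟩
    δ x z ∙ δ z y ∎
    where
      xv∼zy : (x , v) ∼ (z , y)
      xv∼zy = ∼-trans (APStep⇒∼ (sq c)) (APStep⇒∼ (flip yz))
      vy∼xz : (v , y) ∼ (x , z)
      vy∼xz = ∼-trans (APStep⇒∼ (sq (Cycle4-rotate c))) (APStep⇒∼ (flip zx))

  δ-square : ∀ {x v y z} → Cycle4 R G x v y z → δ x v ∙ δ v y ≡ δ x z ∙ δ z y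
  δ-square {x} {v} {y} {z} c with weak-excluded-middle (Adj x y) | weak-excluded-middle (Adj v z)
  ... | inj₂ ¬¬xy | _         = δ-square-in-class (¬¬-map (square-with-chord-xy c) ¬¬xy)
  ... | inj₁ _    | inj₂ ¬¬vz = δ-square-in-class (¬¬-map (square-with-chord-vz c) ¬¬vz)
  ... | inj₁ ¬xy  | inj₁ ¬vz  = δ-square-induced (c , ¬xy , ¬vz)

  -- δ extended to the edges of 𝒳(G); a relation because {x , y} may be a diagonal of several 4-cycles.
  data Step : V → V → ℝ² R G → Set where
    vertex   : ∀ {x} → Step x x 𝟎
    edge     : ∀ {x y} → Adj x y → Step x y (δ x y)
    diagonal : ∀ {x v y z} → Cycle4 R G x v y z → Step x y (δ x v ∙ δ v y)

  diagonals-agree : ∀ {x v y z v′ z′} → Cycle4 R G x v y z → Cycle4 R G x v′ y z′ →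
                    δ x v ∙ δ v y ≡ δ x v′ ∙ δ v′ y
  diagonals-agree {v = v} {v′ = v′} {z′}
                  (x≢y , _ , xv , vy , _ , _) c′@(_ , v′≢z′ , xv′ , v′y , yz′ , z′x)
    with weak-excluded-middle (v ≡ v′)
  ... | inj₁ v≢v′  = δ-square (x≢y , v≢v′ , xv , vy , Adj-sym v′y , Adj-sym xv′)
  ... | inj₂ ¬¬v≡v′ = trans (δ-square (x≢y , v≢z′ , xv , vy , yz′ , z′x)) (sym (δ-square c′))
    where
      v≢z′ : v ≢ z′
      v≢z′ v≡z′ = ¬¬v≡v′ λ v≡v′ → v′≢z′ (trans (sym v≡v′) v≡z′)

  Step-functional : ∀ {x y d d′} → Step x y d → Step x y d′ → d ≡ d′
  Step-functional vertex       vertex        = refl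
  Step-functional vertex       (edge xx)     = ⊥-elim (irrefl xx)
  Step-functional vertex       (diagonal c)  = ⊥-elim (proj₁ c refl)
  Step-functional (edge xx)    vertex        = ⊥-elim (irrefl xx)
  Step-functional (diagonal c) vertex        = ⊥-elim (proj₁ c refl)
  Step-functional (edge _)     (edge _)      = refl
  Step-functional (edge xy)    (diagonal (_ , _ , xv , vy , _ , _)) = sym (δ-triangle (xv , vy , Adj-sym xy))
  Step-functional (diagonal (_ , _ , xv , vy , _ , _)) (edge xy)    = δ-triangle (xv , vy , Adj-sym xy)
  Step-functional (diagonal c) (diagonal c′) = diagonals-agree c c′

  Step-antisym : ∀ {x y d} → Step x y d → Step y x (d ⁻¹)
  Step-antisym vertex = subst (Step _ _) (sym ε⁻¹≈ε) vertex
  Step-antisym (edge xy) = subst (Step _ _) (δ-antisym xy) (edge (Adj-sym xy))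
  Step-antisym (diagonal {x} {v} {y} c@(_ , _ , xv , vy , _ , _)) =
    subst (Step _ _) eq (diagonal (Cycle4-reverse c))
    where
      eq : δ y v ∙ δ v x ≡ (δ x v ∙ δ v y) ⁻¹
      eq = begin
        δ y v ∙ δ v x             ≡⟨ cong₂ _∙_ (δ-antisym vy) (δ-antisym xv) ⟩
        δ v y ⁻¹ ∙ δ x v ⁻¹       ≡⟨ ⁻¹-anti-homo-∙ (δ x v) (δ v y) ⟨
        (δ x v ∙ δ v y) ⁻¹        ∎

  open WalkSums R G Step

  potential-of-differences : ∀ {u v w a b c} → Step u v (b - a) → Step u w (c - a) → Step v w (c - b) →
                             Potential (u ∷ v ∷ w ∷ [])
  potential-of-differences {u} {v} {w} {a} {b} {c} uv uw vw = φ , consistent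
    where
      φ : ∀ {x} → x ∈ u ∷ v ∷ w ∷ [] → ℝ² R G
      φ (here _)                 = a
      φ (there (here _))         = b
      φ (there (there (here _))) = c

      self : ∀ {x} p → Step x x (p - p)
      self p = subst (Step _ _) (sym (inverseʳ p)) vertex

      back : ∀ {x y p q} → Step x y (q - p) → Step y x (p - q)
      back {p = p} {q} xy = subst (Step _ _) (⁻¹-anti-homo‿- q p) (Step-antisym xy)

      consistent : ∀ {x y} (i : x ∈ u ∷ v ∷ w ∷ []) (j : y ∈ u ∷ v ∷ w ∷ []) → Step x y (φ j - φ i)
      consistent (here refl)                 (here refl)                 = self a
      consistent (here refl)                 (there (here refl))         = uv
      consistent (here refl)                 (there (there (here refl))) = uw
      consistent (there (here refl))         (here refl)                 = back uv
      consistent (there (here refl))         (there (here refl))         = self b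
      consistent (there (here refl))         (there (there (here refl))) = vw
      consistent (there (there (here refl))) (here refl)                 = back uw
      consistent (there (there (here refl))) (there (here refl))         = back vw
      consistent (there (there (here refl))) (there (there (here refl))) = self c

  path-potential : ∀ {u v w d e} → Step u v d → Step v w e → Step u w (d ∙ e) → Potential (u ∷ v ∷ w ∷ [])
  path-potential {d = d} {e} uv vw uw = potential-of-differences
    (subst (Step _ _) (sym (x//ε≈x d)) uv)
    (subst (Step _ _) (sym (x//ε≈x (d ∙ e))) uw)
    (subst (Step _ _) (sym (xyx⁻¹≈y d e)) vw)

  segment-potential : ∀ {u v d} → Step u v d → Potential (u ∷ v ∷ [])
  segment-potential {d = d} uv =
    Potential-⊆ (xs⊆xs++ys _ _) (path-potential uv vertex (subst (Step _ _) (sym (identityʳ d)) uv))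

  face-potential : ∀ {S} → InX R G S → Potential S
  face-potential (inj₁ (v , S⊆ , _)) =
    Potential-⊆ S⊆ (Potential-⊆ (xs⊆xs++ys _ _) (segment-potential (vertex {v})))
  face-potential (inj₂ (inj₁ (_ , _ , uv , S⊆ , _))) =
    Potential-⊆ S⊆ (segment-potential (edge uv))
  face-potential (inj₂ (inj₂ (inj₁ (_ , _ , _ , _ , c , S⊆ , _)))) =
    Potential-⊆ S⊆ (segment-potential (diagonal c))
  face-potential (inj₂ (inj₂ (inj₂ (inj₁ (_ , _ , _ , t@(uv , vw , wu) , S⊆ , _))))) =
    Potential-⊆ S⊆ (path-potential (edge uv) (edge vw)
                     (subst (Step _ _) (sym (δ-triangle t)) (edge (Adj-sym wu))))
  face-potential (inj₂ (inj₂ (inj₂ (inj₂ (_ , _ , _ , _ , (c@(_ , _ , uv , vw , _ , _) , _) , S⊆ , _))))) =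
    Potential-⊆ S⊆ (path-potential (edge uv) (edge vw) (diagonal c))

  open Cocycle Step-functional face-potential

  classSum⇒walkSum : ∀ {C s} → Linked Adj C → ClassSum R G ρ r C s → WalkSum C s
  classSum⇒walkSum _ (end x) = [ x ]
  classSum⇒walkSum (xy ∷ L) (inR e~r S) =
    subst (λ d → WalkSum _ (d ∙ _)) (restrict-in-class e~r) (edge xy ∷ classSum⇒walkSum L S)
  classSum⇒walkSum (xy ∷ L) (outR ¬e~r S) =
    subst (WalkSum _) (trans (cong (_∙ _) (restrict-out-of-class ¬e~r)) (identityˡ _))
      (edge xy ∷ classSum⇒walkSum L S)

  -- With 𝒳-walks P from u₀ to u and Q back to u₀, both P Q and P C Q are null-homotopic loops at u₀.
  class-sum-vanishes : ∀ {C s} → SimplyConnectedX R G → ClosedWalk R G C → ClassSum R G ρ r C s → s ≡ 𝟎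
  class-sum-vanishes (walk , u₀ , null) (u , cs , refl , C-adj) C-sum
    with walk u₀ u | walk u u₀
  ... | _ , ps , refl , P | _ , qs , refl , Q
    with walkSum-exists P | walkSum-exists Q
  ... | p , P-sum | q , Q-sum = ε-sandwich p q _
    (null-homotopic-sum null (Linked-⁀ ps P Q) (WalkSum-⁀ ps P-sum Q-sum))
    (null-homotopic-sum null (Linked-⁀ ps P (Linked-⁀ cs C-𝒳 Q))
                        (WalkSum-⁀ ps P-sum (WalkSum-⁀ cs (classSum⇒walkSum C-adj C-sum) Q-sum)))
    where
      adj⇒XAdj : ∀ {x y} → Adj x y → XAdj x y
      adj⇒XAdj xy = inj₂ (inj₁ (_ , _ , xy , ⊆-refl , ⊆-refl))

      C-𝒳 : Linked XAdj (u ∷ cs ++ u ∷ [])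
      C-𝒳 = Linked.map adj⇒XAdj C-adj

lemma1p23 : (R : RealNumbers) (G : Graph) (ρ : Graph.V G → RealNumbers.ℝ R × RealNumbers.ℝ R) →
    IsTPFramework R G ρ → WalkIndependent R G ρ
lemma1p23 R G ρ (placement@(_ , _ , parallelogram) , _ , simply-connected) =
  placement , λ a b _ C C-closed s C-sum →
    ClassDisplacement.class-sum-vanishes R G ρ (proj₁ ∘ parallelogram _ _ _ _) (a , b)
      simply-connected C-closed C-sum
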